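{- Let $\pi$ be a Speh representation with parameters $h, t$ with $h \geq t$. Let $d$ be the greatest common divisor of $n$ and $s$ and write $m$ for the quotient $\tfrac nd$. Define the points $\underline{x}_a := \ell(x_a)$ and $\underline{y}_a := \ell(y_a + 1)$. The following two statements are equivalent: (i) for each invariant $\rho \in \mathbb{Q}/\mathbb{Z}$ the number of indices $a$ such that the point $\underline{x}_a$ has invariant $\rho$ is equal to the number of indices $a$ such that the point $\underline{y}_a$ has invariant $\rho$; (ii) $m$ divides $t$ or $m$ divides $h$.
   Context: Let $F$ be a non-Archimedean local field and $G=\mathrm{Gl}_n(F)$. Let $h,t$ be positive integers with $n = th$. The Speh representation $\mathrm{Speh}(h,t)$ is the unique irreducible quotient of $\mathrm{St}_{G_h}\nu^{(t-1)/2} \times \cdots \times \mathrm{St}_{G_h}\nu^{(1-t)/2}$, where $\nu$ is the absolute value character; it has $t$ segments $S_a = \langle x_a, y_a\rangle$, $a=1,\ldots,t$, with $x_a = \frac{t-h}{2} - (a-1)$ and $y_a = \frac{t+h}{2} - a$. Let $s$ be an integer with $0 \le s \le n$ (the signature). Let $\ell \subset \mathbb{Q}^2$ be the line of slope $\tfrac sn$ through the origin, and for $x \in \mathbb{Q}$ write $\ell(x)$ for the point $(x, \tfrac sn x)$ on $\ell$. To any point $v \in \mathbb{Q}^2$ one associates its invariant $\rho(v) := p_2(v) \in \mathbb{Q}/\mathbb{Z}$, where $p_2\colon \mathbb{Q}^2 \to \mathbb{Q}$ is projection on the second coordinate. -}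

module Defs where

open import Data.Nat as ℕ using (ℕ; NonZero; ≢-nonZero; ≢-nonZero⁻¹)
open import Data.Nat.Properties using (m*n≢0)
open import Data.Nat.GCD using (gcd; gcd[m,n]≢0)
open import Data.Integer as ℤ using (ℤ; +_)
open import Data.Rational as ℚ using (ℚ)
open import Data.List using (List; length; filter; map)
open import Data.List.Base using (upTo)
open import Data.Sum using (inj₁)
open import Relation.Nullary using (Dec)
open import Relation.Binary.PropositionalEquality using (_≡_)

-- The "invariant" ρ(v) = p₂(v) ∈ ℚ/ℤ.  Since ℚ/ℤ is a quotient, we work with
-- representatives: two rationals have the same invariant iff their difference
-- is an integer, i.e. has denominator 1.
_≡ℚ/ℤ_ : ℚ → ℚ → Set
p ≡ℚ/ℤ q = ℚ.ℚ.denominatorℕ (p ℚ.- q) ≡ 1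

_≡ℚ/ℤ?_ : (p q : ℚ) → Dec (p ≡ℚ/ℤ q)
p ≡ℚ/ℤ? q = ℚ.ℚ.denominatorℕ (p ℚ.- q) ℕ.≟ 1

-- Speh(h,t): n = t * h.  Segments indexed by a = 1 … t.
-- x_a = (t - h)/2 - (a - 1),   y_a = (t + h)/2 - a.
segX : (t h a : ℕ) → ℚ
segX t h a = ((+ t ℤ.- + h) ℚ./ 2) ℚ.- (((+ a) ℤ.- + 1) ℚ./ 1)

segY : (t h a : ℕ) → ℚ
segY t h a = ((+ t ℤ.+ + h) ℚ./ 2) ℚ.- ((+ a) ℚ./ 1)

slope : (t h s : ℕ) → .{{NonZero t}} → .{{NonZero h}} → ℚ
slope t h s = ℚ._/_ (+ s) (t ℕ.* h) {{m*n≢0 t h}}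

-- second coordinate of ℓ(x) = (x, (s/n) x)
ℓ₂ : (t h s : ℕ) → .{{NonZero t}} → .{{NonZero h}} → ℚ → ℚ
ℓ₂ t h s x = slope t h s ℚ.* x

invX : (t h s : ℕ) → .{{NonZero t}} → .{{NonZero h}} → ℕ → ℚ
invX t h s a = ℓ₂ t h s (segX t h a)

invY : (t h s : ℕ) → .{{NonZero t}} → .{{NonZero h}} → ℕ → ℚ
invY t h s a = ℓ₂ t h s (segY t h a ℚ.+ 1ℚ)
  where 1ℚ = (+ 1) ℚ./ 1

indices : ℕ → List ℕ
indices t = map ℕ.suc (upTo t)

countInv : (t : ℕ) → (ℕ → ℚ) → ℚ → ℕ
countInv t f ρ = length (filter (λ a → f a ≡ℚ/ℤ? ρ) (indices t))

mQuot : (t h s : ℕ) → .{{NonZero t}} → .{{NonZero h}} → ℕ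
mQuot t h s = ℕ._/_ (t ℕ.* h) (gcd (t ℕ.* h) s)
  {{≢-nonZero (gcd[m,n]≢0 (t ℕ.* h) s (inj₁ (≢-nonZero⁻¹ (t ℕ.* h) {{m*n≢0 t h}})))}}

-- Let n = t·h, ℓ the line of slope s/n,
-- C = (t+h)/2 and Z k = (s/n)·(C − k).  The points x̲_a = ℓ(x_a) and y̲_a = ℓ(y_a+1)
-- have second coordinates Z (h + a − 1) and Z (a − 1), and Z i ≡ Z j (mod ℤ) iff
-- n ∣ s·(i − j) iff m ∣ (i − j), with m = n / gcd(n, s).  So condition (i) says that
-- the windows [h, h+t) and [0, t) of ℕ contain every residue class mod m equally often.
--
-- It then studies windows of an m-periodic predicate on ℕ:
-- if m ∣ t all windows of length t agree, and if m ∣ h the two windows are translates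
-- by a multiple of m (⇐).  Conversely, dropping full periods reduces to t = r, h = v
-- with 0 < r, v < m, and the residue class of v − 1 (if v ≤ r) or of v (if r < v)
-- lies in exactly one of the windows [0, r), [v, v+r) (⇒).  Finally the counts of the
-- theorem are identified with such window counts.
module Submission where

open import Defs
open import Data.Nat using (ℕ; NonZero; _≤_; _*_)
open import Data.Nat.Divisibility using (_∣_)
open import Data.Rational using (ℚ)
open import Data.Sum using (_⊎_)
open import Data.Product using (_×_)
open import Relation.Binary.PropositionalEquality using (_≡_)

open import Data.Nat using (suc; zero)
open import Data.Product using (_,_)

-- Arithmetic of fractions with integer numerator, proved by passing to unnormalised
-- rationals where the identities become ring identities in ℤ.
module IntegerFractions where
  open import Data.Integer as ℤ using (+_)
  open import Data.Integer.Tactic.RingSolver using (solve-∀)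
  open import Data.Rational as ℚ using (_/_)
  import Data.Rational.Properties as ℚP
  open import Data.Rational.Unnormalised as ℚᵘ using (mkℚᵘ; *≡*)
  import Data.Rational.Unnormalised.Properties as ℚᵘP
  open ℚᵘP.≃-Reasoning

  toℚᵘ-/ : ∀ i n → ℚ.toℚᵘ (i / suc n) ℚᵘ.≃ mkℚᵘ i n
  toℚᵘ-/ i n = ℚP.toℚᵘ-fromℚᵘ (mkℚᵘ i n)

  /-+ : ∀ a b n → (a ℤ.+ b) / suc n ≡ a / suc n ℚ.+ b / suc n
  /-+ a b n = ℚP.toℚᵘ-injective (begin
    ℚ.toℚᵘ ((a ℤ.+ b) / suc n)                   ≈⟨ toℚᵘ-/ (a ℤ.+ b) n ⟩
    mkℚᵘ (a ℤ.+ b) n                             ≈⟨ *≡* (identity a b (+ suc n)) ⟩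
    mkℚᵘ a n ℚᵘ.+ mkℚᵘ b n                       ≈⟨ ℚᵘP.+-cong (toℚᵘ-/ a n) (toℚᵘ-/ b n) ⟨
    ℚ.toℚᵘ (a / suc n) ℚᵘ.+ ℚ.toℚᵘ (b / suc n)   ≈⟨ ℚP.toℚᵘ-homo-+ (a / suc n) (b / suc n) ⟨
    ℚ.toℚᵘ (a / suc n ℚ.+ b / suc n)             ∎)
    where
    identity : ∀ a b N → (a ℤ.+ b) ℤ.* (N ℤ.* N) ≡ (a ℤ.* N ℤ.+ b ℤ.* N) ℤ.* N
    identity = solve-∀

  /-cancel : ∀ a n → (a ℤ.* + suc n) / suc n ≡ a / 1
  /-cancel a n = ℚP.toℚᵘ-injective (begin
    ℚ.toℚᵘ ((a ℤ.* + suc n) / suc n)  ≈⟨ toℚᵘ-/ (a ℤ.* + suc n) n ⟩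
    mkℚᵘ (a ℤ.* + suc n) n            ≈⟨ *≡* (identity a (+ suc n)) ⟩
    mkℚᵘ a 0                          ≈⟨ toℚᵘ-/ a 0 ⟨
    ℚ.toℚᵘ (a / 1)                    ∎)
    where
    identity : ∀ a N → (a ℤ.* N) ℤ.* + 1 ≡ a ℤ.* N
    identity = solve-∀

  /-*-/1 : ∀ a b n → (a / suc n) ℚ.* (b / 1) ≡ (a ℤ.* b) / suc n
  /-*-/1 a b n = ℚP.toℚᵘ-injective (begin
    ℚ.toℚᵘ ((a / suc n) ℚ.* (b / 1))             ≈⟨ ℚP.toℚᵘ-homo-* (a / suc n) (b / 1) ⟩
    ℚ.toℚᵘ (a / suc n) ℚᵘ.* ℚ.toℚᵘ (b / 1)       ≈⟨ ℚᵘP.*-cong (toℚᵘ-/ a n) (toℚᵘ-/ b 0) ⟩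
    mkℚᵘ a n ℚᵘ.* mkℚᵘ b 0                       ≈⟨ *≡* (identity a b (+ suc n)) ⟩
    mkℚᵘ (a ℤ.* b) n                             ≈⟨ toℚᵘ-/ (a ℤ.* b) n ⟨
    ℚ.toℚᵘ ((a ℤ.* b) / suc n)                   ∎)
    where
    identity : ∀ a b N → (a ℤ.* b) ℤ.* N ≡ (a ℤ.* b) ℤ.* (N ℤ.* + 1)
    identity = solve-∀

module RationalsModuloIntegers where
  import Data.Nat as ℕ
  import Data.Nat.Properties as ℕP
  open import Data.Nat.Divisibility using (∣-antisym; ∣-refl; 1∣_)
  open import Data.Nat.GCD using (gcd; gcd[m,n]∣m; gcd[m,n]∣n; gcd-greatest)
  import Data.Integer as ℤ
  import Data.Integer.Properties as ℤP
  open import Data.Rational as ℚ using (mkℚ; _/_)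
  import Data.Rational.Properties as ℚP
  open import Data.Rational.Solver using (module +-*-Solver)
  open import Function.Bundles using (_⇔_; mk⇔; Equivalence)
  open import Relation.Binary.PropositionalEquality using (refl; sym; trans; cong; cong₂; subst; module ≡-Reasoning)
  open IntegerFractions using (/-+)

  ↧ₙ-/ : ∀ i n → ℚ.↧ₙ (i / suc n) ℕ.* gcd ℤ.∣ i ∣ (suc n) ≡ suc n
  ↧ₙ-/ i n = ℤP.+-injective (trans (ℤP.pos-* (ℚ.↧ₙ (i / suc n)) (gcd ℤ.∣ i ∣ (suc n))) (ℚP.↧-/ i (suc n)))

  integral⇔∣ : ∀ i n → ℚ.↧ₙ (i / suc n) ≡ 1 ⇔ suc n ∣ ℤ.∣ i ∣
  integral⇔∣ i n = mk⇔ to from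
    where
    to : ℚ.↧ₙ (i / suc n) ≡ 1 → suc n ∣ ℤ.∣ i ∣
    to d≡1 = subst (_∣ ℤ.∣ i ∣) gcd≡N (gcd[m,n]∣m ℤ.∣ i ∣ (suc n))
      where
      gcd≡N : gcd ℤ.∣ i ∣ (suc n) ≡ suc n
      gcd≡N = trans (sym (ℕP.*-identityˡ _)) (subst (λ d → d ℕ.* gcd ℤ.∣ i ∣ (suc n) ≡ suc n) d≡1 (↧ₙ-/ i n))
    from : suc n ∣ ℤ.∣ i ∣ → ℚ.↧ₙ (i / suc n) ≡ 1
    from N∣i = ℕP.*-cancelʳ-≡ _ 1 (suc n)
      (trans (cong (ℚ.↧ₙ (i / suc n) ℕ.*_) (sym gcd≡N)) (trans (↧ₙ-/ i n) (sym (ℕP.*-identityˡ _))))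
      where
      gcd≡N : gcd ℤ.∣ i ∣ (suc n) ≡ suc n
      gcd≡N = ∣-antisym (gcd[m,n]∣n ℤ.∣ i ∣ (suc n)) (gcd-greatest N∣i ∣-refl)

  integer-form : ∀ p → ℚ.↧ₙ p ≡ 1 → p ≡ ℚ.↥ p / 1
  integer-form p@(mkℚ _ zero _) refl = sym (ℚP.↥p/↧p≡p p)

  ≡ℚ/ℤ-sym : ∀ p q → p ≡ℚ/ℤ q → q ≡ℚ/ℤ p
  ≡ℚ/ℤ-sym p q p≈q = begin
    ℚ.↧ₙ (q ℚ.- p)        ≡⟨ cong ℚ.↧ₙ_ (swap p q) ⟩
    ℚ.↧ₙ (ℚ.- (p ℚ.- q))  ≡⟨ ℤP.+-injective (ℚP.↧-neg (p ℚ.- q)) ⟩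
    ℚ.↧ₙ (p ℚ.- q)        ≡⟨ p≈q ⟩
    1                     ∎
    where
    open ≡-Reasoning
    open +-*-Solver
    swap : ∀ p q → q ℚ.- p ≡ ℚ.- (p ℚ.- q)
    swap = solve 2 (λ p q → q :- p := :- (p :- q)) refl

  ≡ℚ/ℤ-trans : ∀ p q r → p ≡ℚ/ℤ q → q ≡ℚ/ℤ r → p ≡ℚ/ℤ r
  ≡ℚ/ℤ-trans p q r p≈q q≈r = begin
    ℚ.↧ₙ (p ℚ.- r)  ≡⟨ cong ℚ.↧ₙ_ p-r≡k/1 ⟩
    ℚ.↧ₙ (k / 1)    ≡⟨ Equivalence.from (integral⇔∣ k 0) (1∣ _) ⟩
    1               ∎
    where
    open ≡-Reasoning
    open +-*-Solver
    k = ℚ.↥ (p ℚ.- q) ℤ.+ ℚ.↥ (q ℚ.- r)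
    telescope : ∀ p q r → p ℚ.- r ≡ (p ℚ.- q) ℚ.+ (q ℚ.- r)
    telescope = solve 3 (λ p q r → p :- r := (p :- q) :+ (q :- r)) refl
    p-r≡k/1 : p ℚ.- r ≡ k / 1
    p-r≡k/1 = trans (telescope p q r)
      (trans (cong₂ ℚ._+_ (integer-form (p ℚ.- q) p≈q) (integer-form (q ℚ.- r) q≈r))
             (sym (/-+ (ℚ.↥ (p ℚ.- q)) (ℚ.↥ (q ℚ.- r)) 0)))

module Divisibility where
  open import Data.Nat as ℕ using (∣_-_∣)
  open import Data.Nat.Divisibility using (*-cancelʳ-∣; *-monoˡ-∣; ∣n⇒∣m*n)
  open import Data.Nat.DivMod using (m/n*n≡m)
  open import Data.Nat.GCD using (gcd; gcd[m,n]∣m; gcd[m,n]∣n)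
  open import Data.Nat.Coprimality using (coprime-/gcd; coprime-divisor)
  open import Data.Nat.Tactic.RingSolver using (solve-∀)
  open import Data.Integer as ℤ using (+_; _⊖_)
  import Data.Integer.Properties as ℤP
  open import Function.Bundles using (_⇔_; mk⇔)
  open import Relation.Binary.PropositionalEquality using (refl; sym; trans; cong; subst₂; module ≡-Reasoning)

  -- N divides s·d iff N / gcd(N, s) divides d: after dividing by g = gcd(N, s) the
  -- factor s/g is coprime to N/g.
  ∣*⇔∣/gcd : ∀ N s d .{{_ : NonZero (gcd N s)}} → N ∣ s * d ⇔ (N ℕ./ gcd N s) ∣ d
  ∣*⇔∣/gcd N s d = mk⇔ to from
    where
    g = gcd N s
    m = N ℕ./ g
    s′ = s ℕ./ g
    m*g≡N : m * g ≡ N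
    m*g≡N = m/n*n≡m (gcd[m,n]∣m N s)
    s′*g≡s : s′ * g ≡ s
    s′*g≡s = m/n*n≡m (gcd[m,n]∣n N s)
    regroup : ∀ a b c → a * b * c ≡ a * c * b
    regroup = solve-∀
    to : N ∣ s * d → m ∣ d
    to N∣sd = coprime-divisor (coprime-/gcd N s) (*-cancelʳ-∣ g mg∣s′dg)
      where
      mg∣s′dg : m * g ∣ s′ * d * g
      mg∣s′dg = subst₂ _∣_ (sym m*g≡N) (trans (cong (_* d) (sym s′*g≡s)) (regroup s′ g d)) N∣sd
    from : m ∣ d → N ∣ s * d
    from m∣d = subst₂ _∣_ m*g≡N (trans (sym (regroup s′ g d)) (cong (_* d) s′*g≡s))
      (*-monoˡ-∣ g (∣n⇒∣m*n s′ m∣d))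

  ⊖-distance : ∀ i j → ℤ.∣ i ⊖ j ∣ ≡ ∣ i - j ∣
  ⊖-distance zero    zero    = refl
  ⊖-distance zero    (suc j) = refl
  ⊖-distance (suc i) zero    = refl
  ⊖-distance (suc i) (suc j) = trans (cong ℤ.∣_∣ (ℤP.[1+m]⊖[1+n]≡m⊖n i j)) (⊖-distance i j)

  ℤ-distance : ∀ i j → ℤ.∣ + j ℤ.- + i ∣ ≡ ∣ i - j ∣
  ℤ-distance i j = begin
    ℤ.∣ + j ℤ.- + i ∣  ≡⟨ cong ℤ.∣_∣ (ℤP.m-n≡m⊖n j i) ⟩
    ℤ.∣ j ⊖ i ∣        ≡⟨ ℤP.∣m⊖n∣≡∣n⊖m∣ j i ⟩
    ℤ.∣ i ⊖ j ∣        ≡⟨ ⊖-distance i j ⟩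
    ∣ i - j ∣          ∎
    where open ≡-Reasoning

module Windows where
  open import Data.Bool using (Bool; true; false)
  open import Data.Nat using (_+_; _<_; _∸_; ∣_-_∣; z<s; s<s; _≤?_; >-nonZero)
  open import Data.Nat.Properties
  open import Data.Nat.Divisibility using (_∤_; _∣?_; divides; _∣0; >⇒∤; m%n≡0⇒n∣m)
  open import Data.Nat.DivMod using (_%_; _/_; m≡m%n+[m/n]*n; m%n<n)
  open import Data.Product using (∃; proj₁; proj₂)
  open import Data.Sum using (inj₁; inj₂)
  open import Data.Empty using (⊥-elim)
  open import Relation.Nullary using (yes; no)
  open import Relation.Binary.PropositionalEquality using (_≢_; refl; sym; trans; cong; cong₂; subst; module ≡-Reasoning)

  ⟦_⟧ : Bool → ℕ
  ⟦ true ⟧  = 1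
  ⟦ false ⟧ = 0

  window : (ℕ → Bool) → ℕ → ℕ → ℕ
  window P j zero    = 0
  window P j (suc L) = ⟦ P j ⟧ + window P (suc j) L

  window-++ : ∀ P j a b → window P j (a + b) ≡ window P j a + window P (j + a) b
  window-++ P j zero    b = cong (λ k → window P k b) (sym (+-identityʳ j))
  window-++ P j (suc a) b = begin
    ⟦ P j ⟧ + window P (suc j) (a + b)                           ≡⟨ cong (⟦ P j ⟧ +_) (window-++ P (suc j) a b) ⟩
    ⟦ P j ⟧ + (window P (suc j) a + window P (suc j + a) b)      ≡⟨ +-assoc ⟦ P j ⟧ _ _ ⟨
    ⟦ P j ⟧ + window P (suc j) a + window P (suc j + a) b        ≡⟨ cong (λ k → ⟦ P j ⟧ + window P (suc j) a + window P k b) (+-suc j a) ⟨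
    ⟦ P j ⟧ + window P (suc j) a + window P (j + suc a) b        ∎
    where open ≡-Reasoning

  Periodic : ℕ → (ℕ → Bool) → Set
  Periodic p P = ∀ k → P (k + p) ≡ P k

  periodic-* : ∀ {p P} → Periodic p P → ∀ q → Periodic (q * p) P
  periodic-* {P = P} per zero k = cong P (+-identityʳ k)
  periodic-* {p} {P} per (suc q) k = begin
    P (k + (p + q * p))  ≡⟨ cong P (+-assoc k p (q * p)) ⟨
    P (k + p + q * p)    ≡⟨ periodic-* per q (k + p) ⟩
    P (k + p)            ≡⟨ per k ⟩
    P k                  ∎
    where open ≡-Reasoning

  window-translate : ∀ {p P} → Periodic p P → ∀ j L → window P (j + p) L ≡ window P j L
  window-translate per j zero    = refl
  window-translate per j (suc L) = cong₂ _+_ (cong ⟦_⟧ (per j)) (window-translate per (suc j) L)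

  -- A window whose length is a period may be slid by one step: the element leaving
  -- and the element entering it have the same value.
  window-slide : ∀ {p P} → Periodic p P → ∀ j → window P (suc j) p ≡ window P j p
  window-slide {p} {P} per j = +-cancelˡ-≡ ⟦ P j ⟧ _ _ (begin
    window P j (suc p)                         ≡⟨ cong (window P j) (+-comm 1 p) ⟩
    window P j (p + 1)                         ≡⟨ window-++ P j p 1 ⟩
    window P j p + (⟦ P (j + p) ⟧ + 0)         ≡⟨ cong (λ b → window P j p + (⟦ b ⟧ + 0)) (per j) ⟩
    window P j p + (⟦ P j ⟧ + 0)               ≡⟨ +-comm (window P j p) _ ⟩
    ⟦ P j ⟧ + 0 + window P j p                 ≡⟨ cong (_+ window P j p) (+-identityʳ ⟦ P j ⟧) ⟩
    ⟦ P j ⟧ + window P j p                     ∎)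
    where open ≡-Reasoning

  window-period-start : ∀ {p P} → Periodic p P → ∀ j → window P j p ≡ window P 0 p
  window-period-start per zero    = refl
  window-period-start per (suc j) = trans (window-slide per j) (window-period-start per j)

  window-multiple-start : ∀ {p P} → Periodic p P → ∀ q j → window P j (q * p) ≡ window P 0 (q * p)
  window-multiple-start per zero    j = refl
  window-multiple-start {p} {P} per (suc q) j = begin
    window P j (p + q * p)                        ≡⟨ window-++ P j p (q * p) ⟩
    window P j p + window P (j + p) (q * p)       ≡⟨ cong₂ _+_ (window-period-start per j) (window-translate per j (q * p)) ⟩
    window P 0 p + window P j (q * p)             ≡⟨ cong (window P 0 p +_) (window-multiple-start per q j) ⟩
    window P 0 p + window P 0 (q * p)             ≡⟨ cong (window P 0 p +_) (window-translate per 0 (q * p)) ⟨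
    window P 0 p + window P p (q * p)             ≡⟨ window-++ P 0 p (q * p) ⟨
    window P 0 (p + q * p)                        ∎
    where open ≡-Reasoning

  window-drop-periods : ∀ {p P} → Periodic p P → ∀ q r j →
    window P j (q * p + r) ≡ window P 0 (q * p) + window P j r
  window-drop-periods {p} {P} per q r j = begin
    window P j (q * p + r)                        ≡⟨ window-++ P j (q * p) r ⟩
    window P j (q * p) + window P (j + q * p) r   ≡⟨ cong₂ _+_ (window-multiple-start per q j) (window-translate (periodic-* per q) j r) ⟩
    window P 0 (q * p) + window P j r             ∎
    where open ≡-Reasoning

  divisible⇒window-invariant : ∀ {m P} → Periodic m P → ∀ t h → m ∣ t ⊎ m ∣ h → window P h t ≡ window P 0 t
  divisible⇒window-invariant per .(q * _) h (inj₁ (divides q refl)) = window-multiple-start per q h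
  divisible⇒window-invariant per t .(q * _) (inj₂ (divides q refl)) = window-translate (periodic-* per q) 0 t

  window-absent : ∀ Q j L → (∀ i → i < L → Q (j + i) ≡ false) → window Q j L ≡ 0
  window-absent Q j zero    absent = refl
  window-absent Q j (suc L) absent = cong₂ _+_
    (cong ⟦_⟧ (trans (cong Q (sym (+-identityʳ j))) (absent 0 z<s)))
    (window-absent Q (suc j) L (λ i i<L → trans (cong Q (sym (+-suc j i))) (absent (suc i) (s<s i<L))))

  window-present : ∀ Q j L i → i < L → Q (j + i) ≡ true → window Q j L ≢ 0
  window-present Q j (suc L) zero    _         Qj =
    subst (λ b → ⟦ b ⟧ + window Q (suc j) L ≢ 0) (sym (trans (cong Q (sym (+-identityʳ j))) Qj)) (λ ())
  window-present Q j (suc L) (suc i) (s<s i<L) Qji = λ w≡0 →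
    window-present Q (suc j) L i i<L (trans (cong Q (sym (+-suc j i))) Qji) (m+n≡0⇒n≡0 ⟦ Q j ⟧ w≡0)

  ResidueIndicator : ℕ → (ℕ → ℕ → Bool) → Set
  ResidueIndicator m R = ∀ c k → (m ∣ ∣ k - c ∣ → R c k ≡ true) × (m ∤ ∣ k - c ∣ → R c k ≡ false)

  strictly-between⇒∤ : ∀ {m d} → 0 < d → d < m → m ∤ d
  strictly-between⇒∤ 0<d d<m = >⇒∤ {{>-nonZero 0<d}} d<m

  -- For 0 < r, v < m, some residue class meets exactly one of [0, r) and [v, v+r):
  -- the class of v − 1 if v ≤ r, the class of v if r < v.
  residue-windows-differ : ∀ {m} R → ResidueIndicator m R → ∀ {r v} → 0 < r → r < m → 0 < v → v < m →
    ∃ λ c → window (R c) v r ≢ window (R c) 0 r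
  residue-windows-differ {m} R ind {r} {suc v} 0<r r<m z<s v<m with suc v ≤? r
  ... | yes v<r = v , λ eq →
    window-present (R v) 0 r v v<r (proj₁ (ind v v) (subst (m ∣_) (sym (∣n-n∣≡0 v)) (m ∣0)))
      (trans (sym eq) (window-absent (R v) (suc v) r λ i i<r → proj₂ (ind v (suc v + i))
        (subst (m ∤_) (sym (distance i)) (strictly-between⇒∤ z<s (≤-<-trans i<r r<m)))))
    where
    distance : ∀ i → ∣ suc v + i - v ∣ ≡ suc i
    distance i = trans (cong (λ k → ∣ k - v ∣) (sym (+-suc v i)))
                       (trans (∣-∣-comm (v + suc i) v) (∣m-m+n∣≡n v (suc i)))
  ... | no v≮r = suc v , λ eq →
    window-present (R (suc v)) (suc v) r 0 0<r (proj₁ (ind (suc v) (suc v + 0))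
        (subst (m ∣_) (sym (m≡n⇒∣m-n∣≡0 (+-identityʳ (suc v)))) (m ∣0)))
      (trans eq (window-absent (R (suc v)) 0 r λ i i<r → proj₂ (ind (suc v) i)
        (subst (m ∤_) (sym (m≤n⇒∣m-n∣≡n∸m (<⇒≤ (i<v i<r))))
          (strictly-between⇒∤ (m<n⇒0<n∸m (i<v i<r)) (≤-<-trans (m∸n≤m (suc v) i) v<m)))))
    where
    r≤v : r ≤ v
    r≤v = ≤-pred (≰⇒> v≮r)
    i<v : ∀ {i} → i < r → i < suc v
    i<v i<r = <-≤-trans i<r (m≤n⇒m≤1+n r≤v)

  tail-windows-agree : ∀ {p P} → Periodic p P → ∀ q r h →
    window P h (q * p + r) ≡ window P 0 (q * p + r) → window P h r ≡ window P 0 r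
  tail-windows-agree {p} {P} per q r h agree = +-cancelˡ-≡ (window P 0 (q * p)) _ _
    (trans (sym (window-drop-periods per q r h)) (trans agree (window-drop-periods per q r 0)))

  window-invariant⇒divisible : ∀ {m} .{{_ : NonZero m}} R → (∀ c → Periodic m (R c)) → ResidueIndicator m R →
    ∀ t h → (∀ c → window (R c) h t ≡ window (R c) 0 t) → m ∣ t ⊎ m ∣ h
  window-invariant⇒divisible {m} R per ind t h invariant with m ∣? t | m ∣? h
  ... | yes m∣t | _       = inj₁ m∣t
  ... | no _    | yes m∣h = inj₂ m∣h
  ... | no m∤t  | no m∤h  =
    let (c , differs) = residue-windows-differ R ind (nonzero-remainder m∤t) (m%n<n t m) (nonzero-remainder m∤h) (m%n<n h m)
    in ⊥-elim (differs (remainder-windows-agree c))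
    where
    nonzero-remainder : ∀ {a} → m ∤ a → 0 < a % m
    nonzero-remainder {a} m∤a = n≢0⇒n>0 (λ a%m≡0 → m∤a (m%n≡0⇒n∣m a m a%m≡0))
    t-decomposed : t ≡ t / m * m + t % m
    t-decomposed = trans (m≡m%n+[m/n]*n t m) (+-comm (t % m) _)
    remainder-windows-agree : ∀ c → window (R c) (h % m) (t % m) ≡ window (R c) 0 (t % m)
    remainder-windows-agree c = begin
      window (R c) (h % m) (t % m)                ≡⟨ window-translate (periodic-* (per c) (h / m)) (h % m) (t % m) ⟨
      window (R c) (h % m + h / m * m) (t % m)    ≡⟨ cong (λ k → window (R c) k (t % m)) (m≡m%n+[m/n]*n h m) ⟨
      window (R c) h (t % m)                      ≡⟨ tail-windows-agree (per c) (t / m) (t % m) h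
                                                       (subst (λ L → window (R c) h L ≡ window (R c) 0 L) t-decomposed (invariant c)) ⟩
      window (R c) 0 (t % m)                      ∎
      where open ≡-Reasoning

module Counting where
  open import Data.Bool using (Bool; true; false)
  import Data.Nat.Properties as ℕP
  open import Data.List using (_∷_; length; filter; applyUpTo)
  open import Function using (_∘_)
  open import Level using (0ℓ)
  open import Relation.Nullary using (does)
  open import Relation.Unary using (Pred; Decidable)
  open import Data.Nat using (_+_)
  open import Relation.Binary.PropositionalEquality using (refl; trans; cong; cong₂; module ≡-Reasoning)
  open Windows using (⟦_⟧; window)

  length-filter-∷ : ∀ {A : Set} {Q : Pred A 0ℓ} (Q? : Decidable Q) x xs →
    length (filter Q? (x ∷ xs)) ≡ ⟦ does (Q? x) ⟧ + length (filter Q? xs)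
  length-filter-∷ Q? x xs with does (Q? x)
  ... | true  = refl
  ... | false = refl

  filter-as-window : ∀ {A : Set} {Q : Pred A 0ℓ} (Q? : Decidable Q) (e : ℕ → A) (W : ℕ → Bool) j L →
    (∀ i → does (Q? (e i)) ≡ W (j + i)) → length (filter Q? (applyUpTo e L)) ≡ window W j L
  filter-as-window Q? e W j zero    agree = refl
  filter-as-window Q? e W j (suc L) agree = begin
    length (filter Q? (e 0 ∷ applyUpTo (e ∘ suc) L))
      ≡⟨ length-filter-∷ Q? (e 0) (applyUpTo (e ∘ suc) L) ⟩
    ⟦ does (Q? (e 0)) ⟧ + length (filter Q? (applyUpTo (e ∘ suc) L))
      ≡⟨ cong₂ _+_ (cong ⟦_⟧ (trans (agree 0) (cong W (ℕP.+-identityʳ j))))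
                     (filter-as-window Q? (e ∘ suc) W (suc j) L (λ i → trans (agree (suc i)) (cong W (ℕP.+-suc j i)))) ⟩
    ⟦ W j ⟧ + window W (suc j) L
      ∎
    where open ≡-Reasoning

module SpehLine (t′ h′ s : ℕ) where
  import Data.Nat as ℕ
  open import Data.Nat using (∣_-_∣)
  import Data.Nat.Properties as ℕP
  open import Data.Nat.Divisibility using (∣-refl)
  open import Data.Nat.GCD using (gcd; gcd[m,n]≢0; m/gcd[m,n]≢0)
  open import Data.Bool using (Bool)
  open import Data.Integer as ℤ using (+_)
  import Data.Integer.Properties as ℤP
  open import Data.Integer.Tactic.RingSolver using (solve-∀)
  open import Data.Rational as ℚ using (_/_)
  open import Data.Rational.Solver using (module +-*-Solver)
  open import Data.List using (length; filter)
  import Data.List.Properties as ListP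
  open import Data.Sum using (inj₁)
  open import Function using (_∘_)
  open import Function.Bundles using (_⇔_; mk⇔; Equivalence)
  open import Function.Properties.Equivalence using (⇔-setoid)
  open import Level using (0ℓ)
  open import Relation.Nullary using (does)
  open import Relation.Nullary.Decidable using (dec-true; dec-false; does-⇔)
  open import Relation.Binary.PropositionalEquality using (refl; sym; trans; cong; cong₂; subst; module ≡-Reasoning)
  open IntegerFractions
  open RationalsModuloIntegers
  open Divisibility
  open Windows
  open Counting

  t h n′ n : ℕ
  t = suc t′
  h = suc h′
  n′ = h′ ℕ.+ t′ ℕ.* h
  n = suc n′

  S C : ℚ
  S = slope t h s
  C = (+ t ℤ.+ + h) / 2

  m : ℕ
  m = mQuot t h s

  instance
    gcd-nonZero : NonZero (gcd n s)
    gcd-nonZero = ℕ.≢-nonZero (gcd[m,n]≢0 n s (inj₁ λ ()))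

    m-nonZero : NonZero m
    m-nonZero = ℕ.≢-nonZero (m/gcd[m,n]≢0 n s)

  Z : ℕ → ℚ
  Z k = S ℚ.* (C ℚ.- + k / 1)

  centre-split : C ≡ (+ t ℤ.- + h) / 2 ℚ.+ + h / 1
  centre-split = begin
    (+ t ℤ.+ + h) / 2                           ≡⟨ cong (_/ 2) (regroup (+ t) (+ h)) ⟩
    ((+ t ℤ.- + h) ℤ.+ + h ℤ.* + 2) / 2         ≡⟨ /-+ (+ t ℤ.- + h) (+ h ℤ.* + 2) 1 ⟩
    (+ t ℤ.- + h) / 2 ℚ.+ (+ h ℤ.* + 2) / 2     ≡⟨ cong ((+ t ℤ.- + h) / 2 ℚ.+_) (/-cancel (+ h) 1) ⟩
    (+ t ℤ.- + h) / 2 ℚ.+ + h / 1               ∎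
    where
    open ≡-Reasoning
    regroup : ∀ a b → a ℤ.+ b ≡ (a ℤ.- b) ℤ.+ b ℤ.* + 2
    regroup = solve-∀

  -- y_a + 1 = C − (a − 1)
  invY-on-line : ∀ i → invY t h s (suc i) ≡ Z i
  invY-on-line i = cong (S ℚ.*_) (begin
    C ℚ.- + suc i / 1 ℚ.+ + 1 / 1                  ≡⟨ cong (λ x → C ℚ.- x ℚ.+ + 1 / 1) (/-+ (+ 1) (+ i) 0) ⟩
    C ℚ.- (+ 1 / 1 ℚ.+ + i / 1) ℚ.+ + 1 / 1        ≡⟨ cancel C (+ 1 / 1) (+ i / 1) ⟩
    C ℚ.- + i / 1                                  ∎)
    where
    open ≡-Reasoning
    open +-*-Solver
    cancel : ∀ c o x → c ℚ.- (o ℚ.+ x) ℚ.+ o ≡ c ℚ.- x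
    cancel = solve 3 (λ c o x → c :- (o :+ x) :+ o := c :- x) refl

  -- x_a = (t−h)/2 − (a − 1) = C − (h + a − 1)
  invX-on-line : ∀ i → invX t h s (suc i) ≡ Z (h ℕ.+ i)
  invX-on-line i = cong (S ℚ.*_) (begin
    (+ t ℤ.- + h) / 2 ℚ.- + i / 1                          ≡⟨ shift ((+ t ℤ.- + h) / 2) (+ h / 1) (+ i / 1) ⟩
    ((+ t ℤ.- + h) / 2 ℚ.+ + h / 1) ℚ.- (+ h / 1 ℚ.+ + i / 1)  ≡⟨ cong₂ ℚ._-_ (sym centre-split) (sym (/-+ (+ h) (+ i) 0)) ⟩
    C ℚ.- + (h ℕ.+ i) / 1                                  ∎)
    where
    open ≡-Reasoning
    open +-*-Solver
    shift : ∀ a b x → a ℚ.- x ≡ (a ℚ.+ b) ℚ.- (b ℚ.+ x)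
    shift = solve 3 (λ a b x → a :- x := (a :+ b) :- (b :+ x)) refl

  Z-difference : ∀ i j → Z i ℚ.- Z j ≡ (+ s ℤ.* (+ j ℤ.- + i)) / n
  Z-difference i j = begin
    Z i ℚ.- Z j                          ≡⟨ factor S C (+ i / 1) (+ j / 1) ⟩
    S ℚ.* (+ j / 1 ℚ.- + i / 1)          ≡⟨ cong (λ x → S ℚ.* (x ℚ.- + i / 1)) j-as-sum ⟩
    S ℚ.* (((+ j ℤ.- + i) / 1 ℚ.+ + i / 1) ℚ.- + i / 1)  ≡⟨ cong (S ℚ.*_) (cancel ((+ j ℤ.- + i) / 1) (+ i / 1)) ⟩
    S ℚ.* ((+ j ℤ.- + i) / 1)            ≡⟨ /-*-/1 (+ s) (+ j ℤ.- + i) n′ ⟩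
    (+ s ℤ.* (+ j ℤ.- + i)) / n          ∎
    where
    open ≡-Reasoning
    open +-*-Solver
    factor : ∀ σ c x y → σ ℚ.* (c ℚ.- x) ℚ.- σ ℚ.* (c ℚ.- y) ≡ σ ℚ.* (y ℚ.- x)
    factor = solve 4 (λ σ c x y → σ :* (c :- x) :- σ :* (c :- y) := σ :* (y :- x)) refl
    cancel : ∀ d x → (d ℚ.+ x) ℚ.- x ≡ d
    cancel = solve 2 (λ d x → (d :+ x) :- x := d) refl
    subtract-add : ∀ a b → (a ℤ.- b) ℤ.+ b ≡ a
    subtract-add = solve-∀
    j-as-sum : + j / 1 ≡ (+ j ℤ.- + i) / 1 ℚ.+ + i / 1
    j-as-sum = trans (cong (_/ 1) (sym (subtract-add (+ j) (+ i)))) (/-+ (+ j ℤ.- + i) (+ i) 0)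

  Z-congruence : ∀ i j → Z i ≡ℚ/ℤ Z j ⇔ m ∣ ∣ i - j ∣
  Z-congruence i j = begin
    ℚ.↧ₙ (Z i ℚ.- Z j) ≡ 1                             ≡⟨ cong (λ q → ℚ.↧ₙ q ≡ 1) (Z-difference i j) ⟩
    ℚ.↧ₙ ((+ s ℤ.* (+ j ℤ.- + i)) / n) ≡ 1             ≈⟨ integral⇔∣ (+ s ℤ.* (+ j ℤ.- + i)) n′ ⟩
    n ∣ ℤ.∣ + s ℤ.* (+ j ℤ.- + i) ∣                   ≡⟨ cong (n ∣_) (trans (ℤP.abs-* (+ s) (+ j ℤ.- + i)) (cong (s ℕ.*_) (ℤ-distance i j))) ⟩
    n ∣ s ℕ.* ∣ i - j ∣                               ≈⟨ ∣*⇔∣/gcd n s ∣ i - j ∣ ⟩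
    m ∣ ∣ i - j ∣                                     ∎
    where open import Relation.Binary.Reasoning.Setoid (⇔-setoid 0ℓ)

  onLine : ℚ → ℕ → Bool
  onLine ρ k = does (Z k ≡ℚ/ℤ? ρ)

  onLine-periodic : ∀ ρ → Periodic m (onLine ρ)
  onLine-periodic ρ k = does-⇔ (mk⇔ (≡ℚ/ℤ-trans (Z k) (Z (k ℕ.+ m)) ρ Zk≈Zk+m)
                                    (≡ℚ/ℤ-trans (Z (k ℕ.+ m)) (Z k) ρ (≡ℚ/ℤ-sym (Z k) (Z (k ℕ.+ m)) Zk≈Zk+m)))
    (Z (k ℕ.+ m) ≡ℚ/ℤ? ρ) (Z k ≡ℚ/ℤ? ρ)
    where
    Zk≈Zk+m : Z k ≡ℚ/ℤ Z (k ℕ.+ m)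
    Zk≈Zk+m = Equivalence.from (Z-congruence k (k ℕ.+ m)) (subst (m ∣_) (sym (ℕP.∣m-m+n∣≡n k m)) ∣-refl)

  onLine-residues : ResidueIndicator m (λ c → onLine (Z c))
  onLine-residues c k = (λ m∣ → dec-true (Z k ≡ℚ/ℤ? Z c) (Equivalence.from (Z-congruence k c) m∣))
                      , (λ m∤ → dec-false (Z k ≡ℚ/ℤ? Z c) (m∤ ∘ Equivalence.to (Z-congruence k c)))

  count-on-line : ∀ (f : ℕ → ℚ) j → (∀ i → f (suc i) ≡ Z (j ℕ.+ i)) → ∀ ρ → countInv t f ρ ≡ window (onLine ρ) j t
  count-on-line f j on-line ρ = trans (cong (λ xs → length (filter (λ a → f a ≡ℚ/ℤ? ρ) xs)) (ListP.map-upTo suc t))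
    (filter-as-window (λ a → f a ≡ℚ/ℤ? ρ) suc (onLine ρ) j t (λ i → cong (λ x → does (x ≡ℚ/ℤ? ρ)) (on-line i)))


open Windows using (window; window-invariant⇒divisible; divisible⇒window-invariant)
open import Relation.Binary.PropositionalEquality using (sym; trans)

-- The counts of x̲_a and y̲_a with invariant ρ are the counts of the windows [h, h+t) and
-- [0, t) of the residue-class predicate onLine ρ, so both directions are window facts.
mainTheorem8 : (t h s : ℕ) → .{{_ : NonZero t}} → .{{_ : NonZero h}} →
    t ≤ h → s ≤ t * h →
    (((ρ : ℚ) → countInv t (invX t h s) ρ ≡ countInv t (invY t h s) ρ) →
      (mQuot t h s ∣ t ⊎ mQuot t h s ∣ h)) ×
    ((mQuot t h s ∣ t ⊎ mQuot t h s ∣ h) →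
      ((ρ : ℚ) → countInv t (invX t h s) ρ ≡ countInv t (invY t h s) ρ))
mainTheorem8 (suc t′) (suc h′) s _ _ = balanced⇒divisible , divisible⇒balanced
  where
  open SpehLine t′ h′ s
  countX : ∀ ρ → countInv t (invX t h s) ρ ≡ window (onLine ρ) h t
  countX = count-on-line (invX t h s) h invX-on-line
  countY : ∀ ρ → countInv t (invY t h s) ρ ≡ window (onLine ρ) 0 t
  countY = count-on-line (invY t h s) 0 invY-on-line
  balanced⇒divisible : (∀ ρ → countInv t (invX t h s) ρ ≡ countInv t (invY t h s) ρ) → m ∣ t ⊎ m ∣ h
  balanced⇒divisible balanced = window-invariant⇒divisible (λ c → onLine (Z c)) (λ c → onLine-periodic (Z c))
    onLine-residues t h (λ c → trans (sym (countX (Z c))) (trans (balanced (Z c)) (countY (Z c))))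
  divisible⇒balanced : m ∣ t ⊎ m ∣ h → ∀ ρ → countInv t (invX t h s) ρ ≡ countInv t (invY t h s) ρ
  divisible⇒balanced m∣t⊎m∣h ρ =
    trans (countX ρ) (trans (divisible⇒window-invariant (onLine-periodic ρ) t h m∣t⊎m∣h) (sym (countY ρ)))
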